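{- Let $n,k$ be integers with $k\ge 2$ and $n\ge 2k$. If $S\subseteq V(J_{n,k})$ is an edge resolving set of the Johnson graph $J_{n,k}$, then for every mutually distinct $x,y,z\in[n]$ it holds that $S\cap \overline{S_{x,y,z}'}\neq\emptyset$, where $\overline{S_{x,y,z}'}=V(J_{n,k})\setminus S_{x,y,z}' = \{\{x,z\} \cup T,\ \{y,z\} \cup T \;:\; T \subset [n] \setminus \{x,y,z\},\ |T|=k-2\}$.
   Context: $[n]=\{1,\dots,n\}$. The Johnson graph $J_{n,k}$ has as vertices all $k$-element subsets of $[n]$, two of them $A,B$ being adjacent iff $|A\cap B|=k-1$; the graph distance is $d(A,B)=k-|A\cap B|$. For an edge $e=uv$ and a vertex $w$, $d(e,w)=\min\{d(u,w),d(v,w)\}$. A set $N\subseteq V(G)$ is an edge resolving set of a connected graph $G$ if for every two distinct edges $e_1,e_2$ of $G$ there is $w\in N$ with $d(e_1,w)\ne d(e_2,w)$. For mutually distinct $x,y,z\in[n]$, $S_{x,y,z}' = V(J_{n,k}) \setminus \{\{x,z\} \cup T,\ \{y,z\} \cup T : T \subset [n] \setminus \{x,y,z\},\ |T|=k-2\}$. The paper considers Johnson graphs only with $n\ge 2k$. -}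

module Defs where

open import Data.Nat using (ℕ; _∸_; _⊓_)
open import Data.Fin using (Fin)
open import Data.Fin.Subset using (Subset; _∩_; _∪_; ⁅_⁆; ∣_∣; _∉_)
open import Data.Product using (Σ; ∃; _×_; _,_)
open import Data.Sum using (_⊎_)
open import Relation.Binary.PropositionalEquality using (_≡_; _≢_)

IsVertex : (n k : ℕ) → Subset n → Set
IsVertex n k A = ∣ A ∣ ≡ k

dist : {n : ℕ} (k : ℕ) → Subset n → Subset n → ℕ
dist k A B = k ∸ ∣ A ∩ B ∣

Adjacent : {n : ℕ} (k : ℕ) → Subset n → Subset n → Set
Adjacent k A B = ∣ A ∩ B ∣ ≡ k ∸ 1

record Edge (n k : ℕ) : Set where
  constructor edge
  field
    u v    : Subset n
    u-vert : IsVertex n k u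
    v-vert : IsVertex n k v
    adj    : Adjacent k u v
open Edge public

SameEdge : {n k : ℕ} → Edge n k → Edge n k → Set
SameEdge e₁ e₂ = (u e₁ ≡ u e₂ × v e₁ ≡ v e₂) ⊎ (u e₁ ≡ v e₂ × v e₁ ≡ u e₂)

edgeDist : {n k : ℕ} → Edge n k → Subset n → ℕ
edgeDist {k = k} e w = dist k (u e) w ⊓ dist k (v e) w

IsEdgeResolving : (n k : ℕ) → (Subset n → Set) → Set
IsEdgeResolving n k N =
  (∀ w → N w → IsVertex n k w) ×
  ((e₁ e₂ : Edge n k) → (SameEdge e₁ e₂ → Data.Empty.⊥) →
     Σ (Subset n) λ w → N w × edgeDist e₁ w ≢ edgeDist e₂ w)
  where import Data.Empty

InCoS' : {n : ℕ} (k : ℕ) (x y z : Fin n) → Subset n → Set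
InCoS' {n} k x y z A =
  Σ (Subset n) λ T →
    x ∉ T × y ∉ T × z ∉ T × ∣ T ∣ ≡ k ∸ 2 ×
    (A ≡ ⁅ x ⁆ ∪ ⁅ z ⁆ ∪ T ⊎ A ≡ ⁅ y ⁆ ∪ ⁅ z ⁆ ∪ T)

{-# OPTIONS --safe #-}
-- Choose t ⊆ [n] ∖ {x,y,z} with |t| = k − 2 (possible since n ≥ 2k ≥ k + 1). The vertices
-- t ∪ {x,y}, t ∪ {x,z}, t ∪ {y,z} form a triangle, and the distance from t ∪ {a,b} to w is
-- k − ([a ∈ w] + [b ∈ w] + |t ∩ w|). A vertex w of S resolving the edges {xy, xz} and
-- {xy, yz} must contain z (otherwise xy is the nearer endpoint of both edges) and exactly one
-- of x, y (otherwise xz and yz are equally far from w); such a w is {x,z} ∪ t' or {y,z} ∪ t'.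
module Submission where

open import Defs
open import Data.Bool using (Bool; true; false)
open import Data.Nat using (ℕ; zero; suc; _+_; _*_; _∸_; _⊓_; _≤_; s≤s)
open import Data.Nat.Properties
  using (≤-trans; m≤m+n; m+n≤o⇒m≤o∸n; ∸-monoʳ-≤; n≤1+n; m≤n⇒m⊓n≡m; ⊓-idem; +-suc)
open import Data.Nat.Tactic.RingSolver using (solve-∀)
open import Data.Fin using (Fin; zero; suc)
open import Data.Fin.Subset
  using (Subset; inside; outside; ⊤; ⊥; ∁; ⁅_⁆; _∪_; _∩_; _-_; ∣_∣; _∈_; _∉_; _⊆_)
open import Data.Fin.Subset.Properties
  using ( x∈⁅x⁆; x∈⁅y⁆⇒x≡y; x∈p∪q⁺; x∈p∪q⁻; q⊆p∪q; ∪-identityˡ; ∩-identityʳ; drop-∷-⊆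
        ; ⊥⊆; ∣⊥∣≡0; ∣⁅x⁆∣≡1; in⊆in; out⊆; x∈p⇒x∉∁p; ∣∁p∣≡n∸∣p∣; p─q⊆p; x∈p∧x≢y⇒x∈p-y; p─⊥≡p)
open import Data.Vec using ([]; _∷_; lookup; here; there)
open import Data.Vec.Properties using ([]=⇒lookup; lookup⇒[]=; lookup-replicate)
open import Data.Product using (Σ; _×_; _,_; ∃-syntax)
open import Data.Sum using (_⊎_; inj₁; inj₂; [_,_]′)
open import Function using (_∘_)
open import Relation.Nullary using (¬_; contradiction)
open import Relation.Binary.PropositionalEquality
  using (_≡_; _≢_; refl; sym; trans; cong; cong₂; subst; module ≡-Reasoning)

private
  variable
    n k j : ℕ
    x y a b : Fin n
    p q t : Subset n

𝟙 : Bool → ℕ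
𝟙 true  = 1
𝟙 false = 0

x∉p⇒lookup≡outside : x ∉ p → lookup p x ≡ outside
x∉p⇒lookup≡outside {x = x} {p} x∉p with lookup p x in eq
... | inside  = contradiction (lookup⇒[]= x p eq) x∉p
... | outside = refl

lookup≡outside⇒x∉p : lookup p x ≡ outside → x ∉ p
lookup≡outside⇒x∉p eq x∈p with () ← trans (sym ([]=⇒lookup x∈p)) eq

𝟙-∈ : x ∈ p → 𝟙 (lookup p x) ≡ 1
𝟙-∈ x∈p = cong 𝟙 ([]=⇒lookup x∈p)

𝟙-∉ : x ∉ p → 𝟙 (lookup p x) ≡ 0
𝟙-∉ x∉p = cong 𝟙 (x∉p⇒lookup≡outside x∉p)

p⊆q⇒p∩q≡p : p ⊆ q → p ∩ q ≡ p
p⊆q⇒p∩q≡p {p = []}          {[]}    _   = refl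
p⊆q⇒p∩q≡p {p = outside ∷ p} {_ ∷ q} p⊆q = cong (outside ∷_) (p⊆q⇒p∩q≡p (drop-∷-⊆ p⊆q))
p⊆q⇒p∩q≡p {p = inside ∷ p}  {_ ∷ q} p⊆q with p⊆q here
... | here = cong (inside ∷_) (p⊆q⇒p∩q≡p (drop-∷-⊆ p⊆q))

∣⁅x⁆∪p∩q∣≡𝟙+∣p∩q∣ : (x : Fin n) (p q : Subset n) → x ∉ p →
                     ∣ (⁅ x ⁆ ∪ p) ∩ q ∣ ≡ 𝟙 (lookup q x) + ∣ p ∩ q ∣
∣⁅x⁆∪p∩q∣≡𝟙+∣p∩q∣ zero    (inside ∷ p)  q             x∉p = contradiction here x∉p
∣⁅x⁆∪p∩q∣≡𝟙+∣p∩q∣ zero    (outside ∷ p) (inside ∷ q)  _   rewrite ∪-identityˡ p = refl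
∣⁅x⁆∪p∩q∣≡𝟙+∣p∩q∣ zero    (outside ∷ p) (outside ∷ q) _   rewrite ∪-identityˡ p = refl
∣⁅x⁆∪p∩q∣≡𝟙+∣p∩q∣ (suc x) (inside ∷ p)  (inside ∷ q)  x∉p =
  trans (cong suc (∣⁅x⁆∪p∩q∣≡𝟙+∣p∩q∣ x p q (x∉p ∘ there)))
        (sym (+-suc (𝟙 (lookup q x)) ∣ p ∩ q ∣))
∣⁅x⁆∪p∩q∣≡𝟙+∣p∩q∣ (suc x) (inside ∷ p)  (outside ∷ q) x∉p = ∣⁅x⁆∪p∩q∣≡𝟙+∣p∩q∣ x p q (x∉p ∘ there)
∣⁅x⁆∪p∩q∣≡𝟙+∣p∩q∣ (suc x) (outside ∷ p) (_ ∷ q)       x∉p = ∣⁅x⁆∪p∩q∣≡𝟙+∣p∩q∣ x p q (x∉p ∘ there)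

∣⁅x⁆∪p∣≡1+∣p∣ : x ∉ p → ∣ ⁅ x ⁆ ∪ p ∣ ≡ suc ∣ p ∣
∣⁅x⁆∪p∣≡1+∣p∣ {x = x} {p} x∉p = begin
  ∣ ⁅ x ⁆ ∪ p ∣               ≡⟨ cong ∣_∣ (∩-identityʳ (⁅ x ⁆ ∪ p)) ⟨
  ∣ (⁅ x ⁆ ∪ p) ∩ ⊤ ∣         ≡⟨ ∣⁅x⁆∪p∩q∣≡𝟙+∣p∩q∣ x p ⊤ x∉p ⟩
  𝟙 (lookup ⊤ x) + ∣ p ∩ ⊤ ∣  ≡⟨ cong₂ (λ b r → 𝟙 b + ∣ r ∣) (lookup-replicate x inside) (∩-identityʳ p) ⟩
  suc ∣ p ∣                   ∎
  where open ≡-Reasoning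

x∉⁅y⁆∪p : x ≢ y → x ∉ p → x ∉ ⁅ y ⁆ ∪ p
x∉⁅y⁆∪p {y = y} {p} x≢y x∉p = [ x≢y ∘ x∈⁅y⁆⇒x≡y y , x∉p ]′ ∘ x∈p∪q⁻ ⁅ y ⁆ p

x∉p-x : ∀ (x : Fin n) p → x ∉ p - x
x∉p-x zero    (_ ∷ p) ()
x∉p-x (suc x) (_ ∷ p) (there x∈p-x) = x∉p-x x p x∈p-x

x∈p⇒p≡⁅x⁆∪p-x : x ∈ p → p ≡ ⁅ x ⁆ ∪ (p - x)
x∈p⇒p≡⁅x⁆∪p-x {p = inside ∷ p} here        = cong (inside ∷_) (sym (trans (∪-identityˡ _) (p─⊥≡p p)))
x∈p⇒p≡⁅x⁆∪p-x {p = s ∷ p}      (there x∈p) = cong (s ∷_) (x∈p⇒p≡⁅x⁆∪p-x x∈p)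

p-x-y⊆p : ∀ (p : Subset n) x y → p - x - y ⊆ p
p-x-y⊆p p x y = p─q⊆p p ⁅ x ⁆ ∘ p─q⊆p (p - x) ⁅ y ⁆

∃⊆-of-size : ∀ m (p : Subset n) → m ≤ ∣ p ∣ → ∃[ q ] q ⊆ p × ∣ q ∣ ≡ m
∃⊆-of-size {n} zero p _ = ⊥ , ⊥⊆ , ∣⊥∣≡0 n
∃⊆-of-size (suc m) (inside ∷ p)  (s≤s m≤∣p∣)
  with q , q⊆p , ∣q∣≡m ← ∃⊆-of-size m p m≤∣p∣ = inside ∷ q , in⊆in q⊆p , cong suc ∣q∣≡m
∃⊆-of-size (suc m) (outside ∷ p) m≤∣p∣
  with q , q⊆p , ∣q∣≡m ← ∃⊆-of-size (suc m) p m≤∣p∣ = outside ∷ q , out⊆ q⊆p , ∣q∣≡m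

pair : Fin n → Fin n → Subset n → Subset n
pair a b t = ⁅ a ⁆ ∪ ⁅ b ⁆ ∪ t

a∈pair : ∀ (a b : Fin n) t → a ∈ pair a b t
a∈pair a b t = x∈p∪q⁺ (inj₁ (x∈⁅x⁆ a))

b∈pair : ∀ (a b : Fin n) t → b ∈ pair a b t
b∈pair a b t = x∈p∪q⁺ (inj₂ (x∈p∪q⁺ (inj₁ (x∈⁅x⁆ b))))

t⊆pair : ∀ (a b : Fin n) t → t ⊆ pair a b t
t⊆pair a b t = q⊆p∪q ⁅ a ⁆ (⁅ b ⁆ ∪ t) ∘ q⊆p∪q ⁅ b ⁆ t

∉pair : x ≢ a → x ≢ b → x ∉ t → x ∉ pair a b t
∉pair x≢a x≢b x∉t = x∉⁅y⁆∪p x≢a (x∉⁅y⁆∪p x≢b x∉t)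

pairDist : ℕ → ℕ → Bool → Bool → ℕ
pairDist k s α β = k ∸ (𝟙 α + (𝟙 β + s))

module _ {a b : Fin n} {t : Subset n} (a≢b : a ≢ b) (a∉t : a ∉ t) (b∉t : b ∉ t) where

  ∣pair∩q∣ : ∀ q → ∣ pair a b t ∩ q ∣ ≡ 𝟙 (lookup q a) + (𝟙 (lookup q b) + ∣ t ∩ q ∣)
  ∣pair∩q∣ q = trans (∣⁅x⁆∪p∩q∣≡𝟙+∣p∩q∣ a (⁅ b ⁆ ∪ t) q (x∉⁅y⁆∪p a≢b a∉t))
                     (cong (𝟙 (lookup q a) +_) (∣⁅x⁆∪p∩q∣≡𝟙+∣p∩q∣ b t q b∉t))

  ∣pair∣ : ∣ pair a b t ∣ ≡ 2 + ∣ t ∣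
  ∣pair∣ = trans (∣⁅x⁆∪p∣≡1+∣p∣ (x∉⁅y⁆∪p a≢b a∉t)) (cong suc (∣⁅x⁆∪p∣≡1+∣p∣ b∉t))

  pair-isVertex : ∣ t ∣ ≡ j → IsVertex n (2 + j) (pair a b t)
  pair-isVertex ∣t∣≡j = trans ∣pair∣ (cong (2 +_) ∣t∣≡j)

  dist-pair : ∀ w → dist k (pair a b t) w ≡ pairDist k (∣ t ∩ w ∣) (lookup w a) (lookup w b)
  dist-pair w = cong (_ ∸_) (∣pair∩q∣ w)

  ∣pair∩q∣≡1+∣t∣ : t ⊆ q → a ∈ q × b ∉ q ⊎ a ∉ q × b ∈ q → ∣ pair a b t ∩ q ∣ ≡ suc ∣ t ∣
  ∣pair∩q∣≡1+∣t∣ {q = q} t⊆q (inj₁ (a∈q , b∉q)) =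
    trans (∣pair∩q∣ q) (cong₂ _+_ (𝟙-∈ a∈q) (cong₂ _+_ (𝟙-∉ b∉q) (cong ∣_∣ (p⊆q⇒p∩q≡p t⊆q))))
  ∣pair∩q∣≡1+∣t∣ {q = q} t⊆q (inj₂ (a∉q , b∈q)) =
    trans (∣pair∩q∣ q) (cong₂ _+_ (𝟙-∉ a∉q) (cong₂ _+_ (𝟙-∈ b∈q) (cong ∣_∣ (p⊆q⇒p∩q≡p t⊆q))))

module PairDecomposition {a b : Fin n} {p : Subset n} (a≢b : a ≢ b) (a∈p : a ∈ p) (b∈p : b ∈ p) where

  p≡pair : p ≡ pair a b (p - a - b)
  p≡pair = trans (x∈p⇒p≡⁅x⁆∪p-x a∈p)
                 (cong (⁅ a ⁆ ∪_) (x∈p⇒p≡⁅x⁆∪p-x (x∈p∧x≢y⇒x∈p-y b∈p (a≢b ∘ sym))))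

  a∉p-a-b : a ∉ p - a - b
  a∉p-a-b = x∉p-x a p ∘ p─q⊆p (p - a) ⁅ b ⁆

  b∉p-a-b : b ∉ p - a - b
  b∉p-a-b = x∉p-x b (p - a)

  ∣p-a-b∣ : ∣ p - a - b ∣ ≡ ∣ p ∣ ∸ 2
  ∣p-a-b∣ = cong (_∸ 2) (trans (sym (∣pair∣ a≢b a∉p-a-b b∉p-a-b)) (cong ∣_∣ (sym p≡pair)))

InCoS'-intro : ∀ {x y z : Fin n} {w} → x ≢ y → x ≢ z → y ≢ z → ∣ w ∣ ≡ k → z ∈ w →
               x ∈ w × y ∉ w ⊎ x ∉ w × y ∈ w → InCoS' k x y z w
InCoS'-intro {x = x} {y} {z} {w} x≢y x≢z y≢z ∣w∣≡k z∈w (inj₁ (x∈w , y∉w)) =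
  w - x - z , a∉p-a-b , y∉w ∘ p-x-y⊆p w x z , b∉p-a-b , trans ∣p-a-b∣ (cong (_∸ 2) ∣w∣≡k) , inj₁ p≡pair
  where open PairDecomposition x≢z x∈w z∈w
InCoS'-intro {x = x} {y} {z} {w} x≢y x≢z y≢z ∣w∣≡k z∈w (inj₂ (x∉w , y∈w)) =
  w - y - z , x∉w ∘ p-x-y⊆p w y z , a∉p-a-b , b∉p-a-b , trans ∣p-a-b∣ (cong (_∸ 2) ∣w∣≡k) , inj₂ p≡pair
  where open PairDecomposition y≢z y∈w z∈w

⊓-pairDist-≢⇒ : ∀ k s (α β γ : Bool) →
  pairDist k s α β ⊓ pairDist k s α γ ≢ pairDist k s α β ⊓ pairDist k s β γ →
  γ ≡ true × (α ≡ true × β ≡ false ⊎ α ≡ false × β ≡ true)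
⊓-pairDist-≢⇒ k s true  false true  _ = refl , inj₁ (refl , refl)
⊓-pairDist-≢⇒ k s false true  true  _ = refl , inj₂ (refl , refl)
⊓-pairDist-≢⇒ k s true  false false ≢ =
  contradiction (trans (⊓-idem _) (sym (m≤n⇒m⊓n≡m (∸-monoʳ-≤ k (n≤1+n s))))) ≢
⊓-pairDist-≢⇒ k s false true  false ≢ =
  contradiction (trans (m≤n⇒m⊓n≡m (∸-monoʳ-≤ k (n≤1+n s))) (sym (⊓-idem _))) ≢
⊓-pairDist-≢⇒ k s true  true  true  ≢ = contradiction refl ≢
⊓-pairDist-≢⇒ k s true  true  false ≢ = contradiction refl ≢
⊓-pairDist-≢⇒ k s false false true  ≢ = contradiction refl ≢
⊓-pairDist-≢⇒ k s false false false ≢ = contradiction refl ≢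

module Triangle {a b c : Fin n} {t : Subset n} {j : ℕ}
                (a≢b : a ≢ b) (a≢c : a ≢ c) (b≢c : b ≢ c)
                (a∉t : a ∉ t) (b∉t : b ∉ t) (c∉t : c ∉ t) (∣t∣≡j : ∣ t ∣ ≡ j) where

  a∉bc : a ∉ pair b c t
  a∉bc = ∉pair a≢b a≢c a∉t

  ab–ac : Edge n (2 + j)
  ab–ac = edge (pair a b t) (pair a c t)
    (pair-isVertex a≢b a∉t b∉t ∣t∣≡j) (pair-isVertex a≢c a∉t c∉t ∣t∣≡j)
    (trans (∣pair∩q∣≡1+∣t∣ a≢b a∉t b∉t (t⊆pair a c t)
             (inj₁ (a∈pair a c t , ∉pair (a≢b ∘ sym) b≢c b∉t)))
           (cong suc ∣t∣≡j))

  ab–bc : Edge n (2 + j)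
  ab–bc = edge (pair a b t) (pair b c t)
    (pair-isVertex a≢b a∉t b∉t ∣t∣≡j) (pair-isVertex b≢c b∉t c∉t ∣t∣≡j)
    (trans (∣pair∩q∣≡1+∣t∣ a≢b a∉t b∉t (t⊆pair b c t) (inj₂ (a∉bc , a∈pair b c t)))
           (cong suc ∣t∣≡j))

  ab–ac≉ab–bc : ¬ SameEdge ab–ac ab–bc
  ab–ac≉ab–bc (inj₁ (_ , ac≡bc)) = a∉bc (subst (a ∈_) ac≡bc (a∈pair a c t))
  ab–ac≉ab–bc (inj₂ (ab≡bc , _)) = a∉bc (subst (a ∈_) ab≡bc (a∈pair a b t))

  edgeDist-ab–ac : ∀ w → edgeDist ab–ac w ≡ pairDist (2 + j) (∣ t ∩ w ∣) (lookup w a) (lookup w b)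
                                       ⊓ pairDist (2 + j) (∣ t ∩ w ∣) (lookup w a) (lookup w c)
  edgeDist-ab–ac w = cong₂ _⊓_ (dist-pair a≢b a∉t b∉t w) (dist-pair a≢c a∉t c∉t w)

  edgeDist-ab–bc : ∀ w → edgeDist ab–bc w ≡ pairDist (2 + j) (∣ t ∩ w ∣) (lookup w a) (lookup w b)
                                       ⊓ pairDist (2 + j) (∣ t ∩ w ∣) (lookup w b) (lookup w c)
  edgeDist-ab–bc w = cong₂ _⊓_ (dist-pair a≢b a∉t b∉t w) (dist-pair b≢c b∉t c∉t w)

  separated⇒ : ∀ w → edgeDist ab–ac w ≢ edgeDist ab–bc w → c ∈ w × (a ∈ w × b ∉ w ⊎ a ∉ w × b ∈ w)
  separated⇒ w d≢
    with ⊓-pairDist-≢⇒ (2 + j) ∣ t ∩ w ∣ (lookup w a) (lookup w b) (lookup w c)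
           (λ eq → d≢ (trans (edgeDist-ab–ac w) (trans eq (sym (edgeDist-ab–bc w)))))
  ... | c∈w , inj₁ (a∈w , b∉w) = lookup⇒[]= c w c∈w , inj₁ (lookup⇒[]= a w a∈w , lookup≡outside⇒x∉p b∉w)
  ... | c∈w , inj₂ (a∉w , b∈w) = lookup⇒[]= c w c∈w , inj₂ (lookup≡outside⇒x∉p a∉w , lookup⇒[]= b w b∈w)

  separating-vertex : (S : Subset n → Set) → IsEdgeResolving n (2 + j) S →
    ∃[ w ] S w × ∣ w ∣ ≡ 2 + j × c ∈ w × (a ∈ w × b ∉ w ⊎ a ∉ w × b ∈ w)
  separating-vertex S (S⊆V , resolves) with w , w∈S , d≢ ← resolves ab–ac ab–bc ab–ac≉ab–bc =
    w , w∈S , S⊆V w w∈S , separated⇒ w d≢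

∃-disjoint-of-size : ∀ j (F : Subset n) → j + ∣ F ∣ ≤ n → ∃[ t ] (∀ {v} → v ∈ F → v ∉ t) × ∣ t ∣ ≡ j
∃-disjoint-of-size {n} j F j+∣F∣≤n
  with t , t⊆∁F , ∣t∣≡j ← ∃⊆-of-size j (∁ F) (subst (j ≤_) (sym (∣∁p∣≡n∸∣p∣ F)) (m+n≤o⇒m≤o∸n j j+∣F∣≤n))
  = t , (λ v∈F → x∈p⇒x∉∁p v∈F ∘ t⊆∁F) , ∣t∣≡j

∣pair-x-y-⁅z⁆∣≡3 : ∀ {x y z : Fin n} → x ≢ y → x ≢ z → y ≢ z → ∣ pair x y ⁅ z ⁆ ∣ ≡ 3
∣pair-x-y-⁅z⁆∣≡3 {z = z} x≢y x≢z y≢z =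
  trans (∣pair∣ x≢y (x≢z ∘ x∈⁅y⁆⇒x≡y z) (y≢z ∘ x∈⁅y⁆⇒x≡y z)) (cong (2 +_) (∣⁅x⁆∣≡1 z))

∃-avoiding : ∀ {x y z : Fin n} → x ≢ y → x ≢ z → y ≢ z → j + 3 ≤ n →
             ∃[ t ] x ∉ t × y ∉ t × z ∉ t × ∣ t ∣ ≡ j
∃-avoiding {n} {j} {x} {y} {z} x≢y x≢z y≢z j+3≤n
  with t , ∉t , ∣t∣≡j ← ∃-disjoint-of-size j (pair x y ⁅ z ⁆)
                          (subst (λ s → j + s ≤ n) (sym (∣pair-x-y-⁅z⁆∣≡3 x≢y x≢z y≢z)) j+3≤n)
  = t , ∉t (a∈pair x y ⁅ z ⁆) , ∉t (b∈pair x y ⁅ z ⁆) , ∉t (t⊆pair x y ⁅ z ⁆ (x∈⁅x⁆ z)) , ∣t∣≡j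

j+3≤2*[2+j] : ∀ j → j + 3 ≤ 2 * (2 + j)
j+3≤2*[2+j] j = subst (j + 3 ≤_) (j+3+[1+j]≡2*[2+j] j) (m≤m+n (j + 3) (suc j))
  where
  j+3+[1+j]≡2*[2+j] : ∀ j → j + 3 + suc j ≡ 2 * (2 + j)
  j+3+[1+j]≡2*[2+j] = solve-∀

corollary3 : (n k : ℕ) → 2 ≤ k → 2 * k ≤ n →
    (S : Subset n → Set) → IsEdgeResolving n k S →
    (x y z : Fin n) → x ≢ y → x ≢ z → y ≢ z →
    Σ (Subset n) λ A → S A × InCoS' k x y z A
corollary3 n (suc (suc j)) (s≤s (s≤s _)) 2k≤n S S-resolving x y z x≢y x≢z y≢z
  with t , x∉t , y∉t , z∉t , ∣t∣≡j ← ∃-avoiding x≢y x≢z y≢z (≤-trans (j+3≤2*[2+j] j) 2k≤n)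
  with w , w∈S , ∣w∣≡k , z∈w , x-or-y∈w ← Triangle.separating-vertex x≢y x≢z y≢z x∉t y∉t z∉t ∣t∣≡j S S-resolving
  = w , w∈S , InCoS'-intro x≢y x≢z y≢z ∣w∣≡k z∈w x-or-y∈w
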